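{- Let $f\in F(n)$ be such that $U\mathcal{A}(f)$ is solid. Then for every $h\in F(n)$, if $\mathcal{A}(f)$ and $\mathcal{A}(h)$ are isomorphic then $f\sim h$.
   Context: $F(n)$ is the set of all functions $\{0,1\}^n\to\{0,1\}^n$, written $f=(f_1,\dots,f_n)$; $e_i$ is the configuration with a $1$ exactly in component $i$; addition is componentwise mod $2$. $\mathcal{A}(f)$ is the digraph on $\{0,1\}^n$ with an arc $x\to x+e_i$ whenever $f_i(x)\neq x_i$; $U\mathcal{A}(f)$ is its underlying undirected graph (edge $xy$ iff there is an arc $x\to y$ or $y\to x$). $Q_n$ is the $n$-cube. For a spanning subgraph $G$ of $Q_n$, an embedding of $G$ is a permutation $\pi$ of $\{0,1\}^n$ with $\pi(x)\pi(y)\in E(Q_n)$ for all $xy\in E(G)$; an edge $xy\in E(Q_n)$ is solid in $G$ if $\pi(x)\pi(y)\in E(Q_n)$ for every embedding $\pi$ of $G$; $G$ is solid if every edge of $Q_n$ is solid in $G$ (equivalently, every embedding of $G$ is an automorphism of $Q_n$). $\mathcal{S}(f)$ has an arc $x\to f(x)$; $f\sim h$ means $\mathcal{S}(f)$ and $\mathcal{S}(h)$ are isomorphic. -}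

module Defs where

open import Data.Nat using (ℕ)
open import Data.Bool using (Bool; _xor_)
open import Data.Fin using (Fin; _≟_)
open import Data.Vec using (Vec; lookup; tabulate; zipWith)
open import Data.Product using (Σ; ∃-syntax; _×_)
open import Data.Sum using (_⊎_)
open import Function.Bundles using (_↔_; _⇔_; Inverse)
open import Relation.Nullary using (¬_)
open import Relation.Nullary.Decidable using (⌊_⌋)
open import Relation.Binary.PropositionalEquality using (_≡_; _≢_)

-- configurations {0,1}^n (Bool: false = 0, true = 1)
Config : ℕ → Set
Config n = Vec Bool n

Fn : ℕ → Set
Fn n = Config n → Config n

e : {n : ℕ} → Fin n → Config n
e i = tabulate (λ j → ⌊ i ≟ j ⌋)

_⊕_ : {n : ℕ} → Config n → Config n → Config n
_⊕_ = zipWith _xor_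

Rel : ℕ → Set₁
Rel n = Config n → Config n → Set

A : {n : ℕ} → Fn n → Rel n
A f x y = ∃[ i ] (lookup (f x) i ≢ lookup x i × y ≡ x ⊕ e i)

UA : {n : ℕ} → Fn n → Rel n
UA f x y = A f x y ⊎ A f y x

Q : (n : ℕ) → Rel n
Q n x y = ∃[ i ] y ≡ x ⊕ e i

Embedding : {n : ℕ} → Rel n → (Config n ↔ Config n) → Set
Embedding {n} G π = ∀ x y → G x y → Q n (Inverse.to π x) (Inverse.to π y)

SolidEdge : {n : ℕ} → Rel n → Config n → Config n → Set
SolidEdge {n} G x y =
  (π : Config n ↔ Config n) → Embedding G π → Q n (Inverse.to π x) (Inverse.to π y)

Solid : {n : ℕ} → Rel n → Set
Solid {n} G = ∀ x y → Q n x y → SolidEdge G x y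

Isomorphic : {n : ℕ} → Rel n → Rel n → Set
Isomorphic {n} R S =
  Σ (Config n ↔ Config n) λ π → ∀ x y → R x y ⇔ S (Inverse.to π x) (Inverse.to π y)

S : {n : ℕ} → Fn n → Rel n
S f x y = f x ≡ y

_∼_ : {n : ℕ} → Fn n → Fn n → Set
f ∼ h = Isomorphic (S f) (S h)

{-# OPTIONS --safe #-}
-- A bijection π that is an isomorphism A(f) ≅ A(h) maps edges of UA(f) to edges of Q_n, so by
-- solidity it is a cube automorphism: π(x + e_i) = π(x) + e_σ(x,i). Comparing the two ways round
-- each square of Q_n (and going back and forth along a single edge) shows σ(x + e_i, j) = σ(x, j)
-- for all i, j, hence π(x + Σ_{i∈L} e_i) = π(x) + Σ_{i∈L} e_σ(x,i). Since π also matches the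
-- coordinates in which f moves x with those in which h moves π(x), applying this to
-- f(x) = x + Σ_{f_i(x)≠x_i} e_i gives π(f(x)) = h(π(x)), so π is an isomorphism S(f) ≅ S(h).
module Submission where

open import Data.Nat using (ℕ)
open import Data.Bool using (true; false; _xor_)
open import Data.Bool.Properties using (xor-assoc; xor-comm; xor-same; xor-identityˡ; xor-identityʳ)
  renaming (_≟_ to _≟ᵇ_)
open import Data.Empty using (⊥-elim)
open import Data.Fin using (Fin; _≟_)
open import Data.List using (List; []; _∷_; map; filter; allFin)
open import Data.List.Properties using (map-cong)
open import Data.List.Membership.Propositional using (_∈_; _∉_)
open import Data.List.Membership.Propositional.Properties
  using (∈-allFin; ∈-filter⁺; ∈-filter⁻; ∈-map⁺; ∈-map⁻)
import Data.List.Relation.Unary.All as All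
open import Data.List.Relation.Unary.All.Properties using (All¬⇒¬Any)
open import Data.List.Relation.Unary.AllPairs using (_∷_)
open import Data.List.Relation.Unary.Any using (here; there)
open import Data.List.Relation.Unary.Unique.Propositional using (Unique)
open import Data.List.Relation.Unary.Unique.Propositional.Properties using (allFin⁺; filter⁺; map⁺)
open import Data.Product using (∃-syntax; _,_; proj₁; proj₂)
open import Data.Sum using (inj₁; inj₂)
open import Data.Vec using ([]; _∷_; lookup; replicate)
open import Data.Vec.Properties
  using (lookup-zipWith; lookup∘tabulate; lookup-replicate; zipWith-assoc; zipWith-comm;
         zipWith-identityˡ; zipWith-identityʳ)
open import Data.Vec.Relation.Binary.Pointwise.Extensional using (ext; Pointwise-≡⇒≡)
open import Function using (_∘_; case_of_)
open import Function.Bundles using (_↔_; _⇔_; Inverse; Injection; Equivalence; mk⇔)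
open import Function.Definitions using (Injective)
open import Function.Properties.Inverse using (↔⇒↣)
open import Relation.Nullary using (Dec; yes; no; does)
open import Relation.Nullary.Decidable using (dec-true; dec-false; isYes≗does)
open import Relation.Binary.PropositionalEquality
open ≡-Reasoning

open import Defs

private
  variable
    n : ℕ

xor≡true⇔≢ : ∀ a b → a xor b ≡ true ⇔ a ≢ b
xor≡true⇔≢ true  true  = mk⇔ (λ ()) (λ ne → ⊥-elim (ne refl))
xor≡true⇔≢ true  false = mk⇔ (λ _ ()) (λ _ → refl)
xor≡true⇔≢ false true  = mk⇔ (λ _ ()) (λ _ → refl)
xor≡true⇔≢ false false = mk⇔ (λ ()) (λ ne → ⊥-elim (ne refl))

𝟘 : Config n
𝟘 = replicate _ false

lookup-⊕ : (x y : Config n) (k : Fin n) → lookup (x ⊕ y) k ≡ lookup x k xor lookup y k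
lookup-⊕ x y k = lookup-zipWith _xor_ k x y

⊕-assoc : (x y z : Config n) → (x ⊕ y) ⊕ z ≡ x ⊕ (y ⊕ z)
⊕-assoc = zipWith-assoc xor-assoc

⊕-comm : (x y : Config n) → x ⊕ y ≡ y ⊕ x
⊕-comm = zipWith-comm xor-comm

⊕-identityˡ : (x : Config n) → 𝟘 ⊕ x ≡ x
⊕-identityˡ = zipWith-identityˡ xor-identityˡ

⊕-identityʳ : (x : Config n) → x ⊕ 𝟘 ≡ x
⊕-identityʳ = zipWith-identityʳ xor-identityʳ

⊕-self : (x : Config n) → x ⊕ x ≡ 𝟘
⊕-self []      = refl
⊕-self (a ∷ x) = cong₂ _∷_ (xor-same a) (⊕-self x)

⊕-cancelˡ : (x y : Config n) → x ⊕ (x ⊕ y) ≡ y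
⊕-cancelˡ x y = begin
  x ⊕ (x ⊕ y)  ≡⟨ ⊕-assoc x x y ⟨
  (x ⊕ x) ⊕ y  ≡⟨ cong (_⊕ y) (⊕-self x) ⟩
  𝟘 ⊕ y        ≡⟨ ⊕-identityˡ y ⟩
  y            ∎

⊕-cancelʳ : (x y : Config n) → (x ⊕ y) ⊕ y ≡ x
⊕-cancelʳ x y = begin
  (x ⊕ y) ⊕ y  ≡⟨ ⊕-assoc x y y ⟩
  x ⊕ (y ⊕ y)  ≡⟨ cong (x ⊕_) (⊕-self y) ⟩
  x ⊕ 𝟘        ≡⟨ ⊕-identityʳ x ⟩
  x            ∎

⊕-swapʳ : (x y z : Config n) → (x ⊕ y) ⊕ z ≡ (x ⊕ z) ⊕ y
⊕-swapʳ x y z = begin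
  (x ⊕ y) ⊕ z  ≡⟨ ⊕-assoc x y z ⟩
  x ⊕ (y ⊕ z)  ≡⟨ cong (x ⊕_) (⊕-comm y z) ⟩
  x ⊕ (z ⊕ y)  ≡⟨ ⊕-assoc x z y ⟨
  (x ⊕ z) ⊕ y  ∎

⊕-injectiveˡ : (x : Config n) {y z : Config n} → x ⊕ y ≡ x ⊕ z → y ≡ z
⊕-injectiveˡ x {y} {z} eq = begin
  y            ≡⟨ ⊕-cancelˡ x y ⟨
  x ⊕ (x ⊕ y)  ≡⟨ cong (x ⊕_) eq ⟩
  x ⊕ (x ⊕ z)  ≡⟨ ⊕-cancelˡ x z ⟩
  z            ∎

lookup-e : (i k : Fin n) → lookup (e i) k ≡ does (i ≟ k)
lookup-e i k = trans (lookup∘tabulate _ k) (isYes≗does (i ≟ k))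

lookup-e-diag : (i : Fin n) → lookup (e i) i ≡ true
lookup-e-diag i = trans (lookup-e i i) (dec-true (i ≟ i) refl)

lookup-e-≢ : {i k : Fin n} → i ≢ k → lookup (e i) k ≡ false
lookup-e-≢ {i = i} {k} i≢k = trans (lookup-e i k) (dec-false (i ≟ k) i≢k)

lookup-e≡true⇒≡ : {i k : Fin n} → lookup (e i) k ≡ true → i ≡ k
lookup-e≡true⇒≡ {i = i} {k} eq with i ≟ k
... | yes i≡k = i≡k
... | no  i≢k with () ← trans (sym eq) (lookup-e-≢ i≢k)

e-injective : {i j : Fin n} → e i ≡ e j → i ≡ j
e-injective {i = i} eq =
  sym (lookup-e≡true⇒≡ (subst (λ v → lookup v i ≡ true) eq (lookup-e-diag i)))

⊕e-injective : (x : Config n) {i j : Fin n} → x ⊕ e i ≡ x ⊕ e j → i ≡ j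
⊕e-injective x = e-injective ∘ ⊕-injectiveˡ x

e⊕e≡e⊕e⇒≡ : {a b c d : Fin n} → e a ⊕ e c ≡ e b ⊕ e d → a ≢ b → d ≢ b → c ≡ b
e⊕e≡e⊕e⇒≡ {a = a} {b} {c} {d} eq a≢b d≢b = lookup-e≡true⇒≡ (begin
  lookup (e c) b                       ≡⟨⟩
  false xor lookup (e c) b             ≡⟨ cong (_xor lookup (e c) b) (lookup-e-≢ a≢b) ⟨
  lookup (e a) b xor lookup (e c) b    ≡⟨ lookup-⊕ (e a) (e c) b ⟨
  lookup (e a ⊕ e c) b                 ≡⟨ cong (λ v → lookup v b) eq ⟩
  lookup (e b ⊕ e d) b                 ≡⟨ lookup-⊕ (e b) (e d) b ⟩
  lookup (e b) b xor lookup (e d) b    ≡⟨ cong₂ _xor_ (lookup-e-diag b) (lookup-e-≢ d≢b) ⟩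
  true                                 ∎)

Σe : List (Fin n) → Config n
Σe []      = 𝟘
Σe (i ∷ L) = e i ⊕ Σe L

lookup-Σe-∉ : {k : Fin n} (L : List (Fin n)) → k ∉ L → lookup (Σe L) k ≡ false
lookup-Σe-∉ {k = k} []      k∉L = lookup-replicate k false
lookup-Σe-∉ {k = k} (i ∷ L) k∉i∷L = begin
  lookup (e i ⊕ Σe L) k               ≡⟨ lookup-⊕ (e i) (Σe L) k ⟩
  lookup (e i) k xor lookup (Σe L) k  ≡⟨ cong₂ _xor_ (lookup-e-≢ i≢k) (lookup-Σe-∉ L (k∉i∷L ∘ there)) ⟩
  false                               ∎
  where
  i≢k : i ≢ k
  i≢k refl = k∉i∷L (here refl)

lookup-Σe-∈ : {k : Fin n} {L : List (Fin n)} → Unique L → k ∈ L → lookup (Σe L) k ≡ true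
lookup-Σe-∈ {k = k} {i ∷ L} (k∉L ∷ _) (here refl) = begin
  lookup (e k ⊕ Σe L) k               ≡⟨ lookup-⊕ (e k) (Σe L) k ⟩
  lookup (e k) k xor lookup (Σe L) k  ≡⟨ cong₂ _xor_ (lookup-e-diag k)
                                                     (lookup-Σe-∉ L (All¬⇒¬Any k∉L)) ⟩
  true                                ∎
lookup-Σe-∈ {k = k} {i ∷ L} (i∉L ∷ uL) (there k∈L) = begin
  lookup (e i ⊕ Σe L) k               ≡⟨ lookup-⊕ (e i) (Σe L) k ⟩
  lookup (e i) k xor lookup (Σe L) k  ≡⟨ cong₂ _xor_ (lookup-e-≢ (All.lookup i∉L k∈L))
                                                     (lookup-Σe-∈ uL k∈L) ⟩
  true                                ∎

Σe-unique : {L : List (Fin n)} {D : Config n} → Unique L →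
            (∀ k → k ∈ L ⇔ lookup D k ≡ true) → Σe L ≡ D
Σe-unique {L = L} {D} uL L⇔D = Pointwise-≡⇒≡ (ext pointwise)
  where
  pointwise : ∀ k → lookup (Σe L) k ≡ lookup D k
  pointwise k with lookup D k in Dk
  ... | true  = lookup-Σe-∈ uL (Equivalence.from (L⇔D k) Dk)
  ... | false = lookup-Σe-∉ L λ k∈L → case trans (sym (Equivalence.to (L⇔D k) k∈L)) Dk of λ ()

supported? : (D : Config n) (i : Fin n) → Dec (lookup D i ≡ true)
supported? D i = lookup D i ≟ᵇ true

support : Config n → List (Fin n)
support {n} D = filter (supported? D) (allFin n)

support-unique : (D : Config n) → Unique (support D)
support-unique {n} D = filter⁺ (supported? D) (allFin⁺ n)

∈-support⇔ : (D : Config n) (i : Fin n) → i ∈ support D ⇔ lookup D i ≡ true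
∈-support⇔ {n} D i =
  mk⇔ (proj₂ ∘ ∈-filter⁻ (supported? D) {xs = allFin n}) (∈-filter⁺ (supported? D) (∈-allFin i))

Σe-support : (D : Config n) → Σe (support D) ≡ D
Σe-support D = Σe-unique (support-unique D) (∈-support⇔ D)

module CubeEmbedding {n : ℕ} (p : Config n → Config n) (p-injective : Injective _≡_ _≡_ p)
                     (p-edge : ∀ x y → Q n x y → Q n (p x) (p y)) where

  σ : Config n → Fin n → Fin n
  σ x i = proj₁ (p-edge x (x ⊕ e i) (i , refl))

  p-⊕e : (x : Config n) (i : Fin n) → p (x ⊕ e i) ≡ p x ⊕ e (σ x i)
  p-⊕e x i = proj₂ (p-edge x (x ⊕ e i) (i , refl))

  σ-injective : (x : Config n) {i j : Fin n} → σ x i ≡ σ x j → i ≡ j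
  σ-injective x {i} {j} σi≡σj = ⊕e-injective x (p-injective (begin
    p (x ⊕ e i)        ≡⟨ p-⊕e x i ⟩
    p x ⊕ e (σ x i)    ≡⟨ cong (λ k → p x ⊕ e k) σi≡σj ⟩
    p x ⊕ e (σ x j)    ≡⟨ p-⊕e x j ⟨
    p (x ⊕ e j)        ∎))

  p-⊕e⊕e : (x : Config n) (i j : Fin n) →
           p ((x ⊕ e i) ⊕ e j) ≡ p x ⊕ (e (σ x i) ⊕ e (σ (x ⊕ e i) j))
  p-⊕e⊕e x i j = begin
    p ((x ⊕ e i) ⊕ e j)                          ≡⟨ p-⊕e (x ⊕ e i) j ⟩
    p (x ⊕ e i) ⊕ e (σ (x ⊕ e i) j)              ≡⟨ cong (_⊕ e (σ (x ⊕ e i) j)) (p-⊕e x i) ⟩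
    (p x ⊕ e (σ x i)) ⊕ e (σ (x ⊕ e i) j)        ≡⟨ ⊕-assoc (p x) _ _ ⟩
    p x ⊕ (e (σ x i) ⊕ e (σ (x ⊕ e i) j))        ∎

  σ-local-diag : (x : Config n) (i : Fin n) → σ (x ⊕ e i) i ≡ σ x i
  σ-local-diag x i = e-injective (⊕-injectiveˡ (e (σ x i)) (⊕-injectiveˡ (p x) (begin
    p x ⊕ (e (σ x i) ⊕ e (σ (x ⊕ e i) i))  ≡⟨ p-⊕e⊕e x i i ⟨
    p ((x ⊕ e i) ⊕ e i)                    ≡⟨ cong p (⊕-cancelʳ x (e i)) ⟩
    p x                                    ≡⟨ ⊕-identityʳ (p x) ⟨
    p x ⊕ 𝟘                                ≡⟨ cong (p x ⊕_) (⊕-self (e (σ x i))) ⟨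
    p x ⊕ (e (σ x i) ⊕ e (σ x i))          ∎)))

  σ-local : (x : Config n) (i j : Fin n) → σ (x ⊕ e i) j ≡ σ x j
  σ-local x i j with i ≟ j
  ... | yes refl = σ-local-diag x i
  ... | no  i≢j  = e⊕e≡e⊕e⇒≡ square (i≢j ∘ σ-injective x) d≢b
    where
    square : e (σ x i) ⊕ e (σ (x ⊕ e i) j) ≡ e (σ x j) ⊕ e (σ (x ⊕ e j) i)
    square = ⊕-injectiveˡ (p x) (begin
      p x ⊕ (e (σ x i) ⊕ e (σ (x ⊕ e i) j))  ≡⟨ p-⊕e⊕e x i j ⟨
      p ((x ⊕ e i) ⊕ e j)                    ≡⟨ cong p (⊕-swapʳ x (e i) (e j)) ⟩
      p ((x ⊕ e j) ⊕ e i)                    ≡⟨ p-⊕e⊕e x j i ⟩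
      p x ⊕ (e (σ x j) ⊕ e (σ (x ⊕ e j) i))  ∎)
    d≢b : σ (x ⊕ e j) i ≢ σ x j
    d≢b d≡b = i≢j (σ-injective (x ⊕ e j) (trans d≡b (sym (σ-local-diag x j))))

  p-⊕Σe : (x : Config n) (L : List (Fin n)) → p (x ⊕ Σe L) ≡ p x ⊕ Σe (map (σ x) L)
  p-⊕Σe x [] = begin
    p (x ⊕ 𝟘)  ≡⟨ cong p (⊕-identityʳ x) ⟩
    p x        ≡⟨ ⊕-identityʳ (p x) ⟨
    p x ⊕ 𝟘    ∎
  p-⊕Σe x (i ∷ L) = begin
    p (x ⊕ (e i ⊕ Σe L))                                ≡⟨ cong p (⊕-assoc x (e i) (Σe L)) ⟨
    p ((x ⊕ e i) ⊕ Σe L)                                ≡⟨ p-⊕Σe (x ⊕ e i) L ⟩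
    p (x ⊕ e i) ⊕ Σe (map (σ (x ⊕ e i)) L)              ≡⟨ cong₂ (λ y M → y ⊕ Σe M) (p-⊕e x i)
                                                                 (map-cong (σ-local x i) L) ⟩
    (p x ⊕ e (σ x i)) ⊕ Σe (map (σ x) L)                ≡⟨ ⊕-assoc (p x) _ _ ⟩
    p x ⊕ (e (σ x i) ⊕ Σe (map (σ x) L))                ∎

Δ : Fn n → Config n → Config n
Δ f x = f x ⊕ x

⊕-Δ : (f : Fn n) (x : Config n) → x ⊕ Δ f x ≡ f x
⊕-Δ f x = trans (cong (x ⊕_) (⊕-comm (f x) x)) (⊕-cancelˡ x (f x))

A⇒Q : {f : Fn n} {x y : Config n} → A f x y → Q n x y
A⇒Q (i , _ , y≡x⊕eᵢ) = i , y≡x⊕eᵢ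

Q-sym : {x y : Config n} → Q n x y → Q n y x
Q-sym {x = x} (i , refl) = i , sym (⊕-cancelʳ x (e i))

A-step⇔Δ : (f : Fn n) (x : Config n) (i : Fin n) → A f x (x ⊕ e i) ⇔ lookup (Δ f x) i ≡ true
A-step⇔Δ f x i = mk⇔ to from
  where
  to : A f x (x ⊕ e i) → lookup (Δ f x) i ≡ true
  to (j , fx≢x , x⊕eᵢ≡x⊕eⱼ) with refl ← ⊕e-injective x x⊕eᵢ≡x⊕eⱼ =
    trans (lookup-⊕ (f x) x i) (Equivalence.from (xor≡true⇔≢ _ _) fx≢x)
  from : lookup (Δ f x) i ≡ true → A f x (x ⊕ e i)
  from Δᵢ = i , Equivalence.to (xor≡true⇔≢ _ _) (trans (sym (lookup-⊕ (f x) x i)) Δᵢ) , refl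

isomorphism⇒embedding : (f h : Fn n) ((π , _) : Isomorphic (A f) (A h)) → Embedding (UA f) π
isomorphism⇒embedding f h (π , iso) x y (inj₁ x→y) = A⇒Q {f = h} (Equivalence.to (iso x y) x→y)
isomorphism⇒embedding f h (π , iso) x y (inj₂ y→x) =
  Q-sym (A⇒Q {f = h} (Equivalence.to (iso y x) y→x))

conjugate⇒∼ : (f h : Fn n) (π : Config n ↔ Config n) →
              (∀ x → Inverse.to π (f x) ≡ h (Inverse.to π x)) → f ∼ h
conjugate⇒∼ f h π πf≡hπ = π , λ x y → mk⇔
  (λ fx≡y → trans (sym (πf≡hπ x)) (cong (Inverse.to π) fx≡y))
  (λ hπx≡πy → Injection.injective (↔⇒↣ π) (trans (πf≡hπ x) hπx≡πy))

module Conjugacy {n : ℕ} (f h : Fn n) (π : Config n ↔ Config n)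
                 (iso : ∀ x y → A f x y ⇔ A h (Inverse.to π x) (Inverse.to π y))
                 (solid : Solid (UA f)) where

  p : Config n → Config n
  p = Inverse.to π

  open CubeEmbedding p (Injection.injective (↔⇒↣ π))
                       (λ x y xy → solid x y xy π (isomorphism⇒embedding f h (π , iso)))

  Δ-σ : (x : Config n) (i : Fin n) → lookup (Δ f x) i ≡ true ⇔ lookup (Δ h (p x)) (σ x i) ≡ true
  Δ-σ x i = mk⇔
    (Equivalence.to (A-step⇔Δ h (p x) (σ x i)) ∘ subst (A h (p x)) (p-⊕e x i)
      ∘ Equivalence.to (iso x (x ⊕ e i)) ∘ Equivalence.from (A-step⇔Δ f x i))
    (Equivalence.to (A-step⇔Δ f x i) ∘ Equivalence.from (iso x (x ⊕ e i))
      ∘ subst (A h (p x)) (sym (p-⊕e x i)) ∘ Equivalence.from (A-step⇔Δ h (p x) (σ x i)))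

  Δh⇒∈-image-σ : (x : Config n) {k : Fin n} → lookup (Δ h (p x)) k ≡ true → ∃[ i ] σ x i ≡ k
  Δh⇒∈-image-σ x {k} Δₖ = i , ⊕e-injective (p x) (begin
    p x ⊕ e (σ x i)  ≡⟨ p-⊕e x i ⟨
    p (x ⊕ e i)      ≡⟨ cong p z≡x⊕eᵢ ⟨
    p z              ≡⟨ pz≡px⊕eₖ ⟩
    p x ⊕ e k        ∎)
    where
    z : Config n
    z = Inverse.from π (p x ⊕ e k)
    pz≡px⊕eₖ : p z ≡ p x ⊕ e k
    pz≡px⊕eₖ = Inverse.strictlyInverseˡ π (p x ⊕ e k)
    x→z : A f x z
    x→z = Equivalence.from (iso x z)
            (subst (A h (p x)) (sym pz≡px⊕eₖ) (Equivalence.from (A-step⇔Δ h (p x) k) Δₖ))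
    i : Fin n
    i = proj₁ (A⇒Q {f = f} x→z)
    z≡x⊕eᵢ : z ≡ x ⊕ e i
    z≡x⊕eᵢ = proj₂ (A⇒Q {f = f} x→z)

  ∈-σ-support⇔ : (x : Config n) (k : Fin n) →
                 k ∈ map (σ x) (support (Δ f x)) ⇔ lookup (Δ h (p x)) k ≡ true
  ∈-σ-support⇔ x k = mk⇔ to from
    where
    to : k ∈ map (σ x) (support (Δ f x)) → lookup (Δ h (p x)) k ≡ true
    to k∈ with i , i∈ , refl ← ∈-map⁻ (σ x) k∈ =
      Equivalence.to (Δ-σ x i) (Equivalence.to (∈-support⇔ (Δ f x) i) i∈)
    from : lookup (Δ h (p x)) k ≡ true → k ∈ map (σ x) (support (Δ f x))
    from Δₖ with i , refl ← Δh⇒∈-image-σ x Δₖ =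
      ∈-map⁺ (σ x) (Equivalence.from (∈-support⇔ (Δ f x) i) (Equivalence.from (Δ-σ x i) Δₖ))

  p∘f≡h∘p : ∀ x → p (f x) ≡ h (p x)
  p∘f≡h∘p x = begin
    p (f x)                                     ≡⟨ cong p (⊕-Δ f x) ⟨
    p (x ⊕ Δ f x)                               ≡⟨ cong (λ D → p (x ⊕ D)) (Σe-support (Δ f x)) ⟨
    p (x ⊕ Σe (support (Δ f x)))                ≡⟨ p-⊕Σe x (support (Δ f x)) ⟩
    p x ⊕ Σe (map (σ x) (support (Δ f x)))      ≡⟨ cong (p x ⊕_) (Σe-unique unique (∈-σ-support⇔ x)) ⟩
    p x ⊕ Δ h (p x)                             ≡⟨ ⊕-Δ h (p x) ⟩
    h (p x)                                     ∎
    where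
    unique : Unique (map (σ x) (support (Δ f x)))
    unique = map⁺ (σ-injective x) (support-unique (Δ f x))

lemma2 : (n : ℕ) (f : Fn n) → Solid (UA f) →
    (h : Fn n) → Isomorphic (A f) (A h) → f ∼ h
lemma2 n f solid h (π , iso) = conjugate⇒∼ f h π p∘f≡h∘p
  where open Conjugacy f h π iso solid
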